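{- For every set $\Gamma\cup\{\varphi\}\subseteq\mathcal{L}_\Diamond(V)$: if $\Gamma\vdash_{\mathcal{GK}^c_\Diamond}\varphi$ then $\Gamma\vdash_{\mathcal{GK}^c}\varphi$.
   Context: $V$ is a countable set of propositional variables. $\mathcal{L}_{\Box\Diamond}(V)$ is the set of formulas built from $V$ and $\bot$ with $\wedge,\vee,\rightarrow$ and unary $\Box,\Diamond$; $\mathcal{L}_\Diamond(V)$ is its $\Box$-free fragment; $\top:=\bot\to\bot$, $\neg\varphi:=\varphi\to\bot$. $\mathcal{GK}^c$: Gödel–Dummett propositional calculus (intuitionistic calculus plus prelinearity $(\varphi\to\psi)\vee(\psi\to\varphi)$, modus ponens) over $\mathcal{L}_{\Box\Diamond}(V)$, plus axioms $\Box(\varphi\to\psi)\to(\Box\varphi\to\Box\psi)$, $\Diamond(\varphi\vee\psi)\to(\Diamond\varphi\vee\Diamond\psi)$, $\Diamond(\varphi\to\psi)\to(\Box\varphi\to\Diamond\psi)$, $(\Diamond\varphi\to\Box\psi)\to\Box(\varphi\to\psi)$, $\neg\Diamond\bot$, $\Box(\varphi\vee\psi)\to(\Box\varphi\vee\Diamond\psi)$, and rules applicable only to theorems: from $\varphi$ infer $\Box\varphi$; from $\varphi\to\psi$ infer $\Diamond\varphi\to\Diamond\psi$. $\mathcal{GK}^c_\Diamond$: Gödel–Dummett propositional calculus over $\mathcal{L}_\Diamond(V)$ plus axioms $(Z_\Diamond)\ \Diamond\neg\neg\varphi\to\neg\neg\Diamond\varphi$, $(K_\Diamond)\ \Diamond(\varphi\vee\psi)\to(\Diamond\varphi\vee\Diamond\psi)$,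 $(F_\Diamond)\ \neg\Diamond\bot$, and the rule (on theorems) $(Nec_\Diamond)$: from $\vdash(\varphi\to\psi)\vee\chi$ infer $\vdash(\Diamond\varphi\to\Diamond\psi)\vee\Diamond\chi$. $\Gamma\vdash_S\varphi$ denotes derivability from premises $\Gamma$ in system $S$. -}

module Defs where

open import Level using (0ℓ)
open import Data.Nat using (ℕ)
open import Function.Bundles using (_↣_)
open import Relation.Unary using (Pred; _∈_)
open import Data.Product using (∃; _×_)
open import Relation.Binary.PropositionalEquality using (_≡_)

Countable : Set → Set
Countable V = V ↣ ℕ

infixr 5 _⇒_
infixr 6 _∨_
infixr 7 _∧_

data Fm (V : Set) : Set where
  var     : V → Fm V
  ⊥'      : Fm V
  _∧_ _∨_ _⇒_ : Fm V → Fm V → Fm V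
  □ ◇     : Fm V → Fm V

data FmD (V : Set) : Set where
  var     : V → FmD V
  ⊥'      : FmD V
  _∧_ _∨_ _⇒_ : FmD V → FmD V → FmD V
  ◇       : FmD V → FmD V

-- L_◇(V) viewed as a subset of L_{□◇}(V)
embed : {V : Set} → FmD V → Fm V
embed (var p)  = var p
embed ⊥'       = ⊥'
embed (φ ∧ ψ)  = embed φ ∧ embed ψ
embed (φ ∨ ψ)  = embed φ ∨ embed ψ
embed (φ ⇒ ψ)  = embed φ ⇒ embed ψ
embed (◇ φ)    = ◇ (embed φ)

module _ {V : Set} where

  ¬_ : Fm V → Fm V
  ¬ φ = φ ⇒ ⊥'

  data AxGK : Fm V → Set where
    a-K     : ∀ φ ψ → AxGK (φ ⇒ ψ ⇒ φ)
    a-S     : ∀ φ ψ χ → AxGK ((φ ⇒ ψ ⇒ χ) ⇒ (φ ⇒ ψ) ⇒ φ ⇒ χ)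
    a-∧₁    : ∀ φ ψ → AxGK (φ ∧ ψ ⇒ φ)
    a-∧₂    : ∀ φ ψ → AxGK (φ ∧ ψ ⇒ ψ)
    a-∧I    : ∀ φ ψ → AxGK (φ ⇒ ψ ⇒ φ ∧ ψ)
    a-∨₁    : ∀ φ ψ → AxGK (φ ⇒ φ ∨ ψ)
    a-∨₂    : ∀ φ ψ → AxGK (ψ ⇒ φ ∨ ψ)
    a-∨E    : ∀ φ ψ χ → AxGK ((φ ⇒ χ) ⇒ (ψ ⇒ χ) ⇒ φ ∨ ψ ⇒ χ)
    a-⊥     : ∀ φ → AxGK (⊥' ⇒ φ)
    a-lin   : ∀ φ ψ → AxGK ((φ ⇒ ψ) ∨ (ψ ⇒ φ))
    a-K□    : ∀ φ ψ → AxGK (□ (φ ⇒ ψ) ⇒ □ φ ⇒ □ ψ)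
    a-K◇    : ∀ φ ψ → AxGK (◇ (φ ∨ ψ) ⇒ ◇ φ ∨ ◇ ψ)
    a-FS1   : ∀ φ ψ → AxGK (◇ (φ ⇒ ψ) ⇒ □ φ ⇒ ◇ ψ)
    a-FS2   : ∀ φ ψ → AxGK ((◇ φ ⇒ □ ψ) ⇒ □ (φ ⇒ ψ))
    a-F◇    : AxGK (¬ ◇ ⊥')
    a-Cd    : ∀ φ ψ → AxGK (□ (φ ∨ ψ) ⇒ □ φ ∨ ◇ ψ)

  -- Theorems of GK^c (rules □-Nec and ◇-monotonicity act on theorems only)
  data ThmGK : Fm V → Set where
    ax    : ∀ {φ} → AxGK φ → ThmGK φ
    mp    : ∀ {φ ψ} → ThmGK (φ ⇒ ψ) → ThmGK φ → ThmGK ψ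
    nec□  : ∀ {φ} → ThmGK φ → ThmGK (□ φ)
    mon◇  : ∀ {φ ψ} → ThmGK (φ ⇒ ψ) → ThmGK (◇ φ ⇒ ◇ ψ)

  data _⊢GK_ (Γ : Pred (Fm V) 0ℓ) : Fm V → Set where
    hyp : ∀ {φ} → φ ∈ Γ → Γ ⊢GK φ
    thm : ∀ {φ} → ThmGK φ → Γ ⊢GK φ
    mp  : ∀ {φ ψ} → Γ ⊢GK (φ ⇒ ψ) → Γ ⊢GK φ → Γ ⊢GK ψ

module _ {V : Set} where

  ¬D_ : FmD V → FmD V
  ¬D φ = φ ⇒ ⊥'

  data AxGKD : FmD V → Set where
    a-K     : ∀ φ ψ → AxGKD (φ ⇒ ψ ⇒ φ)
    a-S     : ∀ φ ψ χ → AxGKD ((φ ⇒ ψ ⇒ χ) ⇒ (φ ⇒ ψ) ⇒ φ ⇒ χ)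
    a-∧₁    : ∀ φ ψ → AxGKD (φ ∧ ψ ⇒ φ)
    a-∧₂    : ∀ φ ψ → AxGKD (φ ∧ ψ ⇒ ψ)
    a-∧I    : ∀ φ ψ → AxGKD (φ ⇒ ψ ⇒ φ ∧ ψ)
    a-∨₁    : ∀ φ ψ → AxGKD (φ ⇒ φ ∨ ψ)
    a-∨₂    : ∀ φ ψ → AxGKD (ψ ⇒ φ ∨ ψ)
    a-∨E    : ∀ φ ψ χ → AxGKD ((φ ⇒ χ) ⇒ (ψ ⇒ χ) ⇒ φ ∨ ψ ⇒ χ)
    a-⊥     : ∀ φ → AxGKD (⊥' ⇒ φ)
    a-lin   : ∀ φ ψ → AxGKD ((φ ⇒ ψ) ∨ (ψ ⇒ φ))
    a-Z◇    : ∀ φ → AxGKD (◇ (¬D ¬D φ) ⇒ ¬D ¬D ◇ φ)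
    a-K◇    : ∀ φ ψ → AxGKD (◇ (φ ∨ ψ) ⇒ ◇ φ ∨ ◇ ψ)
    a-F◇    : AxGKD (¬D ◇ ⊥')

  data ThmGKD : FmD V → Set where
    ax    : ∀ {φ} → AxGKD φ → ThmGKD φ
    mp    : ∀ {φ ψ} → ThmGKD (φ ⇒ ψ) → ThmGKD φ → ThmGKD ψ
    nec◇  : ∀ {φ ψ χ} → ThmGKD ((φ ⇒ ψ) ∨ χ) → ThmGKD ((◇ φ ⇒ ◇ ψ) ∨ ◇ χ)

  data _⊢GKD_ (Γ : Pred (FmD V) 0ℓ) : FmD V → Set where
    hyp : ∀ {φ} → φ ∈ Γ → Γ ⊢GKD φ
    thm : ∀ {φ} → ThmGKD φ → Γ ⊢GKD φ
    mp  : ∀ {φ ψ} → Γ ⊢GKD (φ ⇒ ψ) → Γ ⊢GKD φ → Γ ⊢GKD ψ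

embedSet : {V : Set} → Pred (FmD V) 0ℓ → Pred (Fm V) 0ℓ
embedSet {V} Γ ψ = ∃ λ (φ : FmD V) → φ ∈ Γ × embed φ ≡ ψ

-- GK^c_◇ is contained in the ◇-fragment of GK^c: apart from Z◇ and the
-- rule Nec◇ its axioms and rules are literally those of GK^c.  Z◇ follows
-- from FS1, FS2 and F◇: under ¬◇φ, FS2 yields □¬φ, and FS1 combines it with
-- ◇¬¬φ into ◇⊥.  Nec◇ is admissible: □-necessitation of (φ ⇒ ψ) ∨ χ and Cd
-- give □(φ ⇒ ψ) ∨ ◇χ, and FS1 turns □(φ ⇒ ψ) into ◇φ ⇒ ◇ψ.
module Submission where

open import Defs
open import Level using (0ℓ)
open import Relation.Unary using (Pred)
open import Data.List using (List; []; _∷_)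
open import Data.List.Membership.Propositional using () renaming (_∈_ to _∈ₗ_)
open import Data.List.Relation.Unary.Any using (here; there)
open import Relation.Binary.PropositionalEquality using (refl)
open import Data.Product using (_,_)

module _ {V : Set} where

  infix 2 _⊢_

  data _⊢_ (Δ : List (Fm V)) : Fm V → Set where
    hyp : ∀ {φ} → φ ∈ₗ Δ → Δ ⊢ φ
    thm : ∀ {φ} → ThmGK φ → Δ ⊢ φ
    mp  : ∀ {φ ψ} → Δ ⊢ φ ⇒ ψ → Δ ⊢ φ → Δ ⊢ ψ

  axiom : ∀ {Δ φ} → AxGK φ → Δ ⊢ φ
  axiom a = thm (ax a)

  hyp₀ : ∀ {Δ φ} → φ ∷ Δ ⊢ φ
  hyp₀ = hyp (here refl)

  hyp₁ : ∀ {Δ φ ψ} → ψ ∷ φ ∷ Δ ⊢ φ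
  hyp₁ = hyp (there (here refl))

  ⇒-refl : ∀ {Δ} φ → Δ ⊢ φ ⇒ φ
  ⇒-refl φ = mp (mp (axiom (a-S φ (φ ⇒ φ) φ)) (axiom (a-K φ (φ ⇒ φ)))) (axiom (a-K φ φ))

  deduction : ∀ {Δ φ ψ} → φ ∷ Δ ⊢ ψ → Δ ⊢ φ ⇒ ψ
  deduction {φ = φ} (hyp (here refl))      = ⇒-refl φ
  deduction {φ = φ} (hyp {ψ} (there ψ∈Δ)) = mp (axiom (a-K ψ φ)) (hyp ψ∈Δ)
  deduction {φ = φ} (thm {ψ} ⊢ψ)          = mp (axiom (a-K ψ φ)) (thm ⊢ψ)
  deduction {φ = φ} (mp {α} {β} f a)       = mp (mp (axiom (a-S φ α β)) (deduction f)) (deduction a)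

  []⊢⇒ThmGK : ∀ {φ} → [] ⊢ φ → ThmGK φ
  []⊢⇒ThmGK (hyp ())
  []⊢⇒ThmGK (thm ⊢φ)  = ⊢φ
  []⊢⇒ThmGK (mp f a)  = mp ([]⊢⇒ThmGK f) ([]⊢⇒ThmGK a)

  Z◇-derivable : ∀ φ → ThmGK (◇ (¬ ¬ φ) ⇒ ¬ ¬ ◇ φ)
  Z◇-derivable φ = []⊢⇒ThmGK (deduction (deduction
    (mp (axiom a-F◇) (mp (mp (axiom (a-FS1 (¬ φ) ⊥')) hyp₁) □¬φ))))
    where
    □¬φ : ¬ ◇ φ ∷ ◇ (¬ ¬ φ) ∷ [] ⊢ □ (¬ φ)
    □¬φ = mp (axiom (a-FS2 φ ⊥'))
             (deduction (mp (axiom (a-⊥ (□ ⊥'))) (mp hyp₁ hyp₀)))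

  □⇒-◇-mono : ∀ {Δ} φ ψ → □ (φ ⇒ ψ) ∷ Δ ⊢ ◇ φ ⇒ ◇ ψ
  □⇒-◇-mono φ ψ =
    deduction (mp (mp (axiom (a-FS1 (φ ⇒ ψ) ψ)) (mp (thm (mon◇ modusPonens)) hyp₀)) hyp₁)
    where
    modusPonens : ThmGK (φ ⇒ (φ ⇒ ψ) ⇒ ψ)
    modusPonens = []⊢⇒ThmGK (deduction (deduction (mp hyp₀ hyp₁)))

  Nec◇-admissible : ∀ {φ ψ χ} → ThmGK ((φ ⇒ ψ) ∨ χ) → ThmGK ((◇ φ ⇒ ◇ ψ) ∨ ◇ χ)
  Nec◇-admissible {φ} {ψ} {χ} ⊢φ⇒ψ∨χ = []⊢⇒ThmGK
    (mp (mp (mp (axiom (a-∨E (□ (φ ⇒ ψ)) (◇ χ) _))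
                (deduction (mp (axiom (a-∨₁ _ _)) (□⇒-◇-mono φ ψ))))
            (deduction (mp (axiom (a-∨₂ _ _)) hyp₀)))
        (mp (axiom (a-Cd (φ ⇒ ψ) χ)) (thm (nec□ ⊢φ⇒ψ∨χ))))

  embed-ThmGKD : ∀ {φ} → ThmGKD φ → ThmGK (embed φ)
  embed-ThmGKD (ax (a-K φ ψ))     = ax (a-K _ _)
  embed-ThmGKD (ax (a-S φ ψ χ))   = ax (a-S _ _ _)
  embed-ThmGKD (ax (a-∧₁ φ ψ))    = ax (a-∧₁ _ _)
  embed-ThmGKD (ax (a-∧₂ φ ψ))    = ax (a-∧₂ _ _)
  embed-ThmGKD (ax (a-∧I φ ψ))    = ax (a-∧I _ _)
  embed-ThmGKD (ax (a-∨₁ φ ψ))    = ax (a-∨₁ _ _)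
  embed-ThmGKD (ax (a-∨₂ φ ψ))    = ax (a-∨₂ _ _)
  embed-ThmGKD (ax (a-∨E φ ψ χ))  = ax (a-∨E _ _ _)
  embed-ThmGKD (ax (a-⊥ φ))       = ax (a-⊥ _)
  embed-ThmGKD (ax (a-lin φ ψ))   = ax (a-lin _ _)
  embed-ThmGKD (ax (a-Z◇ φ))      = Z◇-derivable (embed φ)
  embed-ThmGKD (ax (a-K◇ φ ψ))    = ax (a-K◇ _ _)
  embed-ThmGKD (ax a-F◇)          = ax a-F◇
  embed-ThmGKD (mp f a)           = mp (embed-ThmGKD f) (embed-ThmGKD a)
  embed-ThmGKD (nec◇ ⊢φ)          = Nec◇-admissible (embed-ThmGKD ⊢φ)

  embed-⊢GKD : ∀ {Γ φ} → Γ ⊢GKD φ → embedSet Γ ⊢GK embed φ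
  embed-⊢GKD {φ = φ} (hyp φ∈Γ) = hyp (φ , φ∈Γ , refl)
  embed-⊢GKD (thm ⊢φ)          = thm (embed-ThmGKD ⊢φ)
  embed-⊢GKD (mp f a)          = mp (embed-⊢GKD f) (embed-⊢GKD a)

lemma2 : {V : Set} → Countable V → (Γ : Pred (FmD V) 0ℓ) (φ : FmD V) →
         Γ ⊢GKD φ → embedSet Γ ⊢GK embed φ
lemma2 _ _ _ = embed-⊢GKD
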